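{- Let $G$ be a $k$-Ore graph not isomorphic to $K_k$. Then for every subgraph $K$ of $G$ isomorphic to $K_{k-1}$, the graph $G - V(K)$ contains a subgraph isomorphic to $K_{k-1}$.
   Context: Ore composition of graphs $H_1,H_2$: delete an edge $xy$ of $H_1$; split a vertex $z$ of $H_2$ into two vertices $z_1,z_2$ of positive degree with $N(z_1)\cup N(z_2)=N(z)$ and $N(z_1)\cap N(z_2)=\emptyset$; identify $x$ with $z_1$ and $y$ with $z_2$. A graph is $k$-Ore if it is $K_k$ or an Ore composition of two $k$-Ore graphs. -}

module Defs where

open import Data.Nat using (ℕ)
open import Data.Fin using (Fin)
open import Data.Bool using (Bool; true; false)
open import Data.Product using (Σ; ∃; _×_; _,_)
open import Data.Sum using (_⊎_; inj₁; inj₂)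
open import Relation.Nullary using (¬_)
open import Relation.Binary.PropositionalEquality using (_≡_; _≢_; refl)
  renaming (sym to ≡-sym)
open import Function.Bundles using (_↔_; _⇔_; Inverse)

record Graph : Set₁ where
  field
    n      : ℕ
    Adj    : Fin n → Fin n → Set
    sym    : ∀ {u v} → Adj u v → Adj v u
    irrefl : ∀ {u} → ¬ Adj u u
open Graph public

K : ℕ → Graph
K k = record
  { n = k
  ; Adj = λ u v → u ≢ v
  ; sym = λ p q → p (≡-sym q)
  ; irrefl = λ p → p refl
  }

_≅_ : Graph → Graph → Set
G ≅ H = Σ (Fin (n G) ↔ Fin (n H)) λ φ →
  ∀ u v → Adj G u v ⇔ Adj H (Inverse.to φ u) (Inverse.to φ v)

VMinus : (H : Graph) → Fin (n H) → Set
VMinus H z = Σ (Fin (n H)) λ v → v ≢ z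

-- Adjacency of the Ore composition of H1 and H2, on the vertex set
-- V(H1) ⊎ (V(H2) - z): the edge xy of H1 is deleted, z is split into
-- z1 = x and z2 = y; a neighbour w of z goes to z1 if side w ≡ true
-- and to z2 if side w ≡ false.
OreAdj : (H1 H2 : Graph) (x y : Fin (n H1)) (z : Fin (n H2)) (side : Fin (n H2) → Bool) →
         Fin (n H1) ⊎ VMinus H2 z → Fin (n H1) ⊎ VMinus H2 z → Set
OreAdj H1 H2 x y z side (inj₁ a) (inj₁ b) =
  Adj H1 a b × ¬ ((a ≡ x × b ≡ y) ⊎ (a ≡ y × b ≡ x))
OreAdj H1 H2 x y z side (inj₂ (u , _)) (inj₂ (v , _)) = Adj H2 u v
OreAdj H1 H2 x y z side (inj₁ a) (inj₂ (w , _)) =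
  Adj H2 z w × ((a ≡ x × side w ≡ true) ⊎ (a ≡ y × side w ≡ false))
OreAdj H1 H2 x y z side (inj₂ (w , _)) (inj₁ a) =
  Adj H2 z w × ((a ≡ x × side w ≡ true) ⊎ (a ≡ y × side w ≡ false))

record OreComposition (H1 H2 G : Graph) : Set where
  field
    x y   : Fin (n H1)
    xy    : Adj H1 x y
    z     : Fin (n H2)
    side  : Fin (n H2) → Bool
    z1pos : ∃ λ w → Adj H2 z w × side w ≡ true
    z2pos : ∃ λ w → Adj H2 z w × side w ≡ false
    φ     : Fin (n G) ↔ (Fin (n H1) ⊎ VMinus H2 z)
    adj   : ∀ u v → Adj G u v ⇔ OreAdj H1 H2 x y z side (Inverse.to φ u) (Inverse.to φ v)

data IsOre (k : ℕ) : Graph → Set₁ where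
  base : ∀ {G} → G ≅ K k → IsOre k G
  comp : ∀ {H1 H2 G} → IsOre k H1 → IsOre k H2 → OreComposition H1 H2 G → IsOre k G

Clique : (G : Graph) → ℕ → Set
Clique G m = Σ (Fin m → Fin (n G)) λ f → ∀ i j → i ≢ j → Adj G (f i) (f j)

Disjoint : (G : Graph) {m m' : ℕ} → Clique G m → Clique G m' → Set
Disjoint G (f , _) (g , _) = ∀ i j → f i ≢ g j

-- Every k-Ore graph G has, for each vertex v, a K_{k-1} avoiding v: in K_k delete v, and in
-- an Ore composition take such a clique in H2 avoiding z (if v lies on the H1 side) or in H1
-- avoiding x (otherwise); a clique of H1 missing an endpoint of xy survives the deletion of xy.
-- Now let C be a K_{k-1} in G = H1 ∘ H2. If C has no vertex on the H2 side, a clique of H2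
-- avoiding z is disjoint from it. Otherwise some vertex w of C lies in H2 - z, and every H1-vertex
-- of C is adjacent to w, hence is x or y; not both occur, as xy was deleted. So all H1-vertices
-- of C equal one endpoint u, and a clique of H1 avoiding u is disjoint from C.
module Submission where

open import Defs
open import Data.Nat using (ℕ; zero; suc; _∸_)
open import Data.Fin using (Fin; punchIn)
open import Data.Fin.Properties using (punchIn-injective; punchInᵢ≢i; any?; _≟_)
open import Data.Product using (Σ; ∃; _×_; _,_; proj₁)
open import Data.Sum using (_⊎_; inj₁; inj₂)
open import Data.Sum.Properties using (inj₁-injective)
open import Data.Empty using (⊥-elim)
open import Function using (_∘_)
open import Relation.Nullary using (¬_; Dec; yes; no)
open import Relation.Nullary.Decidable using (map′)
open import Relation.Binary.PropositionalEquality
  using (_≡_; _≢_; refl; cong; subst₂; ≢-sym)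
  renaming (sym to ≡-sym; trans to ≡-trans)
open import Function.Bundles using (Inverse; Equivalence)

CliqueAvoiding : (G : Graph) → ℕ → Fin (n G) → Set
CliqueAvoiding G m v = Σ (Clique G m) λ C → ∀ i → proj₁ C i ≢ v

complete-cliqueAvoiding : ∀ {m} G → G ≅ K (suc m) → ∀ v → CliqueAvoiding G m v
complete-cliqueAvoiding G (ψ , adj) v = ((from ∘ punchIn (to v)) , clique) , avoids
  where
  open Inverse ψ using (to; from) renaming (strictlyInverseˡ to to∘from)

  clique : ∀ i j → i ≢ j → Adj G (from (punchIn (to v) i)) (from (punchIn (to v) j))
  clique i j i≢j = Equivalence.from (adj _ _)
    (subst₂ _≢_ (≡-sym (to∘from _)) (≡-sym (to∘from _)) (i≢j ∘ punchIn-injective (to v) i j))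

  avoids : ∀ i → from (punchIn (to v) i) ≢ v
  avoids i e = punchInᵢ≢i (to v) i (≡-trans (≡-sym (to∘from _)) (cong to e))

module Composition {H1 H2 G : Graph} (O : OreComposition H1 H2 G) where
  open OreComposition O
  open Inverse φ using (to; from) renaming (strictlyInverseˡ to to∘from)

  V : Set
  V = Fin (n H1) ⊎ VMinus H2 z

  R : V → V → Set
  R = OreAdj H1 H2 x y z side

  DeletedEdge : Fin (n H1) → Fin (n H1) → Set
  DeletedEdge a b = (a ≡ x × b ≡ y) ⊎ (a ≡ y × b ≡ x)

  adj-from : ∀ s t → R s t → Adj G (from s) (from t)
  adj-from s t r = Equivalence.from (adj (from s) (from t))
    (subst₂ R (≡-sym (to∘from s)) (≡-sym (to∘from t)) r)

  adj-to : ∀ {u v} → Adj G u v → R (to u) (to v)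
  adj-to {u} {v} = Equivalence.to (adj u v)

  inj₁≢inj₂ : ∀ {a : Fin (n H1)} {b : VMinus H2 z} → inj₁ a ≢ inj₂ b
  inj₁≢inj₂ ()

  x≢y : x ≢ y
  x≢y refl = irrefl H1 xy

  ¬R-x-y : ¬ R (inj₁ x) (inj₁ y)
  ¬R-x-y (_ , notDeleted) = notDeleted (inj₁ (refl , refl))

  rightNeighbour⇒endpoint : ∀ {a w} → R (inj₁ a) (inj₂ w) → a ≡ x ⊎ a ≡ y
  rightNeighbour⇒endpoint (_ , inj₁ (a≡x , _)) = inj₁ a≡x
  rightNeighbour⇒endpoint (_ , inj₂ (a≡y , _)) = inj₂ a≡y

  IsRight : V → Set
  IsRight t = ∃ λ b → t ≡ inj₂ b

  isRight? : ∀ t → Dec (IsRight t)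
  isRight? (inj₁ _) = no λ { (_ , ()) }
  isRight? (inj₂ b) = yes (b , refl)

  embedRight : ∀ {m} → CliqueAvoiding H2 m z → Clique G m
  embedRight ((d , clique) , avoids) =
    (λ i → from (inj₂ (d i , avoids i))) , λ i j i≢j → adj-from _ _ (clique i j i≢j)

  embedRight-avoids : ∀ {m} (D : CliqueAvoiding H2 m z) {v} →
    ¬ IsRight (to v) → ∀ j → proj₁ (embedRight D) j ≢ v
  embedRight-avoids ((d , _) , avoids) notRight j refl = notRight (_ , to∘from _)

  avoidsEndpoint⇒¬DeletedEdge : ∀ {m u} {d : Fin m → Fin (n H1)} → u ≡ x ⊎ u ≡ y →
    (∀ i → d i ≢ u) → ∀ i j → ¬ DeletedEdge (d i) (d j)
  avoidsEndpoint⇒¬DeletedEdge (inj₁ refl) avoids i j (inj₁ (dᵢ≡x , _)) = avoids i dᵢ≡x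
  avoidsEndpoint⇒¬DeletedEdge (inj₁ refl) avoids i j (inj₂ (_ , dⱼ≡x)) = avoids j dⱼ≡x
  avoidsEndpoint⇒¬DeletedEdge (inj₂ refl) avoids i j (inj₁ (_ , dⱼ≡y)) = avoids j dⱼ≡y
  avoidsEndpoint⇒¬DeletedEdge (inj₂ refl) avoids i j (inj₂ (dᵢ≡y , _)) = avoids i dᵢ≡y

  embedLeft : ∀ {m u} → u ≡ x ⊎ u ≡ y → CliqueAvoiding H1 m u → Clique G m
  embedLeft endpoint ((d , clique) , avoids) = (λ i → from (inj₁ (d i))) , λ i j i≢j →
    adj-from _ _ (clique i j i≢j , avoidsEndpoint⇒¬DeletedEdge endpoint avoids i j)

  embedLeft-avoids : ∀ {m u} (endpoint : u ≡ x ⊎ u ≡ y) (D : CliqueAvoiding H1 m u) {v} →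
    (∀ a → to v ≡ inj₁ a → a ≡ u) → ∀ j → proj₁ (embedLeft endpoint D) j ≢ v
  embedLeft-avoids _ ((d , _) , avoids) onlyU j refl = avoids j (onlyU _ (to∘from _))

  cliqueAvoiding : ∀ {m} → (∀ v → CliqueAvoiding H1 m v) → (∀ v → CliqueAvoiding H2 m v) →
    ∀ v → CliqueAvoiding G m v
  cliqueAvoiding avoid₁ avoid₂ v with to v in eq
  ... | inj₁ _ = embedRight D , embedRight-avoids D λ (_ , e) → inj₁≢inj₂ (≡-trans (≡-sym eq) e)
    where D = avoid₂ z
  ... | inj₂ _ = embedLeft (inj₁ refl) D ,
    embedLeft-avoids (inj₁ refl) D λ _ e → ⊥-elim (inj₁≢inj₂ (≡-trans (≡-sym e) eq))
    where D = avoid₁ x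

  ≡inj₁? : (t : V) (a : Fin (n H1)) → Dec (t ≡ inj₁ a)
  ≡inj₁? (inj₁ a′) a = map′ (cong inj₁) inj₁-injective (a′ ≟ a)
  ≡inj₁? (inj₂ _) a = no λ ()

  NoRightVertex : ∀ {m} → Clique G m → Set
  NoRightVertex (c , _) = ∀ i → ¬ IsRight (to (c i))

  OnlyLeftVertex : ∀ {m} → Clique G m → Fin (n H1) → Set
  OnlyLeftVertex (c , _) u = ∀ i a → to (c i) ≡ inj₁ a → a ≡ u

  leftVertices-endpoints : ∀ {m} (C : Clique G m) {i₀} → IsRight (to (proj₁ C i₀)) →
    ∀ i a → to (proj₁ C i) ≡ inj₁ a → a ≡ x ⊎ a ≡ y
  leftVertices-endpoints (c , clique) {i₀} (w , e₀) i a e =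
    rightNeighbour⇒endpoint {w = w} (subst₂ R e e₀ (adj-to (clique i i₀ i≢i₀)))
    where
    i≢i₀ : i ≢ i₀
    i≢i₀ refl = inj₁≢inj₂ (≡-trans (≡-sym e) e₀)

  cliqueSides : ∀ {m} (C : Clique G m) →
    NoRightVertex C ⊎ ∃ λ u → (u ≡ x ⊎ u ≡ y) × OnlyLeftVertex C u
  cliqueSides C@(c , clique) with any? (λ i → isRight? (to (c i)))
  ... | no noRight = inj₁ λ i right → noRight (i , right)
  ... | yes (_ , right) with any? (λ j → ≡inj₁? (to (c j)) y)
  ...   | yes (j , eⱼ) = inj₂ (y , inj₂ refl , onlyY)
    where
    onlyY : OnlyLeftVertex C y
    onlyY i a e with leftVertices-endpoints C right i a e
    ... | inj₂ a≡y = a≡y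
    ... | inj₁ a≡x = ⊥-elim (¬R-x-y (subst₂ R eᵢ eⱼ (adj-to (clique i j i≢j))))
      where
      eᵢ : to (c i) ≡ inj₁ x
      eᵢ = ≡-trans e (cong inj₁ a≡x)
      i≢j : i ≢ j
      i≢j refl = x≢y (inj₁-injective (≡-trans (≡-sym eᵢ) eⱼ))
  ...   | no noY = inj₂ (x , inj₁ refl , onlyX)
    where
    onlyX : OnlyLeftVertex C x
    onlyX i a e with leftVertices-endpoints C right i a e
    ... | inj₁ a≡x = a≡x
    ... | inj₂ a≡y = ⊥-elim (noY (i , ≡-trans e (cong inj₁ a≡y)))

  disjointClique : ∀ {m} → (∀ v → CliqueAvoiding H1 m v) → (∀ v → CliqueAvoiding H2 m v) →
    (C : Clique G m) → Σ (Clique G m) λ D → Disjoint G C D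
  disjointClique avoid₁ avoid₂ C with cliqueSides C
  ... | inj₁ noRight =
    embedRight D , λ i j → ≢-sym (embedRight-avoids D (noRight i) j)
    where D = avoid₂ z
  ... | inj₂ (u , endpoint , onlyU) =
    embedLeft endpoint D , λ i j → ≢-sym (embedLeft-avoids endpoint D (onlyU i) j)
    where D = avoid₁ u

ore-cliqueAvoiding : ∀ {k G} → IsOre k G → ∀ v → CliqueAvoiding G (k ∸ 1) v
ore-cliqueAvoiding {zero} (base (ψ , _)) v with Inverse.to ψ v
... | ()
ore-cliqueAvoiding {suc m} {G} (base iso) = complete-cliqueAvoiding {m} G iso
ore-cliqueAvoiding (comp ore₁ ore₂ O) =
  Composition.cliqueAvoiding O (ore-cliqueAvoiding ore₁) (ore-cliqueAvoiding ore₂)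

mainTheorem4 : (k : ℕ) (G : Graph) → IsOre k G → ¬ (G ≅ K k) →
    (C : Clique G (k ∸ 1)) → Σ (Clique G (k ∸ 1)) λ D → Disjoint G C D
mainTheorem4 k G (base iso) notComplete C = ⊥-elim (notComplete iso)
mainTheorem4 k G (comp ore₁ ore₂ O) _ =
  Composition.disjointClique O (ore-cliqueAvoiding ore₁) (ore-cliqueAvoiding ore₂)
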